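{- For all groups $G,H$ and every formula $\phi$ of $\mathcal{RCD}$: (1) if $G\cap H=\emptyset$, then $R_GR_H\phi\leftrightarrow R_HR_G\phi$ is valid; (2) $R_GR_G\phi\leftrightarrow R_G\phi$ is valid.
   Context: Fix a countable set $\textsc{prop}$ of propositional variables and a finite set $\textsc{ag}$ of agents; groups are nonempty subsets of $\textsc{ag}$. The language $\mathcal{RCD}$ is $\phi ::= p \mid \neg\phi \mid \phi\wedge\phi \mid K_i\phi \mid D_G\phi \mid C_G\phi \mid R_G\phi$. A model is $\mathfrak{M}=(S,\sim,V)$ with each $\sim_i$ an equivalence relation on $S$ and $V:\textsc{prop}\to 2^S$; for any model, its group relation is $\sim_G=\bigcap_{i\in G}\sim_i$. The $G$-resolved update is $\mathfrak{M}|_G=(S,\sim|_G,V)$ with $(\sim|_G)_i=\sim_G$ for $i\in G$ and $\sim_i$ otherwise. Satisfaction: atoms via $V$; Booleans as usual; $K_i\phi$ at $s$ iff $\phi$ at all $t$ with $s\sim_it$; $D_G\phi$ iff $\phi$ at all $t$ with $s\sim_Gt$; $C_G\phi$ iff $\phi$ at all $t$ reachable from $s$ via the reflexive transitive closure of $\bigcup_{i\in G}\sim_i$; $\mathfrak{M},s\models R_G\phi$ iff $\mathfrak{M}|_G,s\models\phi$. Valid = true at every state of every model. -}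

module Defs where

open import Data.Nat using (ℕ)
open import Data.Fin using (Fin)
open import Data.Fin.Subset using (Subset; _∈_; Nonempty; _∩_; Empty)
open import Data.Product using (_×_; Σ; proj₁)
open import Data.Sum using (_⊎_)
open import Data.Empty using (⊥)
open import Relation.Nullary using (¬_)
open import Relation.Binary using (Rel; IsEquivalence)
open import Relation.Binary.Construct.Closure.ReflexiveTransitive using (Star)
open import Function.Bundles using (_⇔_)
open import Level using (0ℓ)

Prop : Set
Prop = ℕ

Group : ℕ → Set
Group n = Σ (Subset n) Nonempty

members : ∀ {n} → Group n → Subset n
members = proj₁

data Form (n : ℕ) : Set where
  var : Prop → Form n
  ¬'_ : Form n → Form n
  _∧'_ : Form n → Form n → Form n
  K : Fin n → Form n → Form n
  D : Group n → Form n → Form n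
  C : Group n → Form n → Form n
  R : Group n → Form n → Form n

record Model (n : ℕ) : Set₁ where
  field
    S : Set
    rel : Fin n → Rel S 0ℓ
    isEquiv : ∀ i → IsEquivalence (rel i)
    V : Prop → S → Set
open Model public

groupRel : ∀ {n} {S : Set} → (Fin n → Rel S 0ℓ) → Group n → Rel S 0ℓ
groupRel r G s t = ∀ i → i ∈ members G → r i s t

unionRel : ∀ {n} {S : Set} → (Fin n → Rel S 0ℓ) → Group n → Rel S 0ℓ
unionRel {n} r G s t = Σ (Fin n) λ i → i ∈ members G × r i s t

resolveRel : ∀ {n} {S : Set} → (Fin n → Rel S 0ℓ) → Group n → Fin n → Rel S 0ℓ
resolveRel r G i s t = (i ∈ members G × groupRel r G s t) ⊎ (¬ (i ∈ members G) × r i s t)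

sat : ∀ {n} {S : Set} → (Fin n → Rel S 0ℓ) → (Prop → S → Set) → S → Form n → Set
sat r V s (var p) = V p s
sat r V s (¬' φ) = ¬ sat r V s φ
sat r V s (φ ∧' ψ) = sat r V s φ × sat r V s ψ
sat r V s (K i φ) = ∀ t → r i s t → sat r V t φ
sat r V s (D G φ) = ∀ t → groupRel r G s t → sat r V t φ
sat r V s (C G φ) = ∀ t → Star (unionRel r G) s t → sat r V t φ
sat r V s (R G φ) = sat (resolveRel r G) V s φ

_,_⊨_ : ∀ {n} (M : Model n) → S M → Form n → Set
M , s ⊨ φ = sat (rel M) (V M) s φ

ValidIff : ∀ {n} → Form n → Form n → Set₁
ValidIff {n} φ ψ = (M : Model n) (s : S M) → (M , s ⊨ φ) ⇔ (M , s ⊨ ψ)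

-- Satisfaction only depends on the agents' relations up to pointwise
-- equivalence, so both validities reduce to equivalences between the relation
-- families of the updated models. Resolving G twice changes nothing, since an
-- agent of G already sees exactly ~_G after the first update. For disjoint G
-- and H, each agent is affected by at most one of the two updates, and the
-- group relation of G computed after the H-update is still the original ~_G.

module Submission where

open import Defs
open import Data.Nat using (ℕ)
open import Data.Fin using (Fin)
open import Data.Fin.Subset using (_∩_; Empty; _∈_)
open import Data.Fin.Subset.Properties using (x∈p∩q⁺)
open import Data.Product using (_×_; _,_; proj₁; proj₂; swap)
open import Data.Sum using (inj₁; inj₂)
open import Data.Empty using (⊥; ⊥-elim)
open import Relation.Binary using (Rel; _⇒_)
open import Relation.Binary.Core using () renaming (_⇔_ to _⇔ʳ_)
import Relation.Binary.Construct.Closure.ReflexiveTransitive as Star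
open import Function.Bundles using (_⇔_; mk⇔)
open import Level using (0ℓ)

Relations : ℕ → Set → Set₁
Relations n S = Fin n → Rel S 0ℓ

infix 4 _≋_

_≋_ : ∀ {n S} → Relations n S → Relations n S → Set
r ≋ r′ = ∀ i → r i ⇔ʳ r′ i

Disjoint : ∀ {n} → Group n → Group n → Set
Disjoint G H = ∀ {i} → i ∈ members G → i ∈ members H → ⊥

Empty-∩⇒Disjoint : ∀ {n} (G H : Group n) → Empty (members G ∩ members H) → Disjoint G H
Empty-∩⇒Disjoint G H empty i∈G i∈H = empty (_ , x∈p∩q⁺ (i∈G , i∈H))

module _ {n S} {r r′ : Relations n S} where

  ≋-sym : r ≋ r′ → r′ ≋ r
  ≋-sym r≋r′ i = swap (r≋r′ i)

  groupRel-resp : r ≋ r′ → ∀ G → groupRel r G ⇒ groupRel r′ G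
  groupRel-resp r≋r′ G rG j j∈G = proj₁ (r≋r′ j) (rG j j∈G)

  unionRel-resp : r ≋ r′ → ∀ G → unionRel r G ⇒ unionRel r′ G
  unionRel-resp r≋r′ G (j , j∈G , rj) = j , j∈G , proj₁ (r≋r′ j) rj

  resolveRel-resp : r ≋ r′ → ∀ G i → resolveRel r G i ⇒ resolveRel r′ G i
  resolveRel-resp r≋r′ G i (inj₁ (i∈G , rG)) = inj₁ (i∈G , groupRel-resp r≋r′ G rG)
  resolveRel-resp r≋r′ G i (inj₂ (i∉G , ri)) = inj₂ (i∉G , proj₁ (r≋r′ i) ri)

resolveRel-cong : ∀ {n S} {r r′ : Relations n S} → r ≋ r′ → ∀ G →
                  resolveRel r G ≋ resolveRel r′ G
resolveRel-cong r≋r′ G i =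
  resolveRel-resp r≋r′ G i , resolveRel-resp (≋-sym r≋r′) G i

sat-resp : ∀ {n S} {r r′ : Relations n S} (V : Prop → S → Set) → r ≋ r′ →
           ∀ s φ → sat r V s φ → sat r′ V s φ
sat-resp V r≋r′ s (var p)   h          = h
sat-resp V r≋r′ s (¬' φ)    h h′       = h (sat-resp V (≋-sym r≋r′) s φ h′)
sat-resp V r≋r′ s (φ ∧' ψ)  (hφ , hψ)  = sat-resp V r≋r′ s φ hφ , sat-resp V r≋r′ s ψ hψ
sat-resp V r≋r′ s (K i φ)   h t st     = sat-resp V r≋r′ t φ (h t (proj₂ (r≋r′ i) st))
sat-resp V r≋r′ s (D G φ)   h t st     =
  sat-resp V r≋r′ t φ (h t (groupRel-resp (≋-sym r≋r′) G st))
sat-resp V r≋r′ s (C G φ)   h t st     =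
  sat-resp V r≋r′ t φ (h t (Star.map (unionRel-resp (≋-sym r≋r′) G) st))
sat-resp V r≋r′ s (R G φ)   h          = sat-resp V (resolveRel-cong r≋r′ G) s φ h

sat-⇔ : ∀ {n S} {r r′ : Relations n S} (V : Prop → S → Set) → r ≋ r′ →
        ∀ s φ → sat r V s φ ⇔ sat r′ V s φ
sat-⇔ V r≋r′ s φ = mk⇔ (sat-resp V r≋r′ s φ) (sat-resp V (≋-sym r≋r′) s φ)

resolveRel-idem : ∀ {n S} (r : Relations n S) G →
                  resolveRel (resolveRel r G) G ≋ resolveRel r G
resolveRel-idem r G i = collapse , expand
  where
  collapse : resolveRel (resolveRel r G) G i ⇒ resolveRel r G i
  collapse (inj₁ (i∈G , rG)) = rG i i∈G
  collapse (inj₂ (_ , ri))   = ri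

  expand : resolveRel r G i ⇒ resolveRel (resolveRel r G) G i
  expand (inj₁ (i∈G , rG)) = inj₁ (i∈G , λ j j∈G → inj₁ (j∈G , rG))
  expand (inj₂ (i∉G , ri)) = inj₂ (i∉G , inj₂ (i∉G , ri))

resolveRel-swap : ∀ {n S} (r : Relations n S) G H → Disjoint G H → ∀ i →
                  resolveRel (resolveRel r H) G i ⇒ resolveRel (resolveRel r G) H i
resolveRel-swap r G H G#H i {s} {t} (inj₁ (i∈G , rG)) =
  inj₂ (G#H i∈G , inj₁ (i∈G , λ j j∈G → unresolved j∈G (rG j j∈G)))
  where
  unresolved : ∀ {j} → j ∈ members G → resolveRel r H j s t → r j s t
  unresolved j∈G (inj₁ (j∈H , _)) = ⊥-elim (G#H j∈G j∈H)
  unresolved j∈G (inj₂ (_ , rj))  = rj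
resolveRel-swap r G H G#H i (inj₂ (i∉G , inj₁ (i∈H , rH))) =
  inj₁ (i∈H , λ j j∈H → inj₂ ((λ j∈G → G#H j∈G j∈H) , rH j j∈H))
resolveRel-swap r G H G#H i (inj₂ (i∉G , inj₂ (i∉H , ri))) =
  inj₂ (i∉H , inj₂ (i∉G , ri))

resolveRel-comm : ∀ {n S} (r : Relations n S) G H → Disjoint G H →
                  resolveRel (resolveRel r G) H ≋ resolveRel (resolveRel r H) G
resolveRel-comm r G H G#H i =
  resolveRel-swap r H G (λ i∈H i∈G → G#H i∈G i∈H) i , resolveRel-swap r G H G#H i

proposition5 : (n : ℕ) (G H : Group n) (φ : Form n) →
    (Empty (members G ∩ members H) → ValidIff (R G (R H φ)) (R H (R G φ)))
    × ValidIff (R G (R G φ)) (R G φ)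
proposition5 n G H φ =
  (λ empty M s → sat-⇔ (V M) (resolveRel-comm (rel M) G H (Empty-∩⇒Disjoint G H empty)) s φ) ,
  (λ M s → sat-⇔ (V M) (resolveRel-idem (rel M) G) s φ)
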